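{- Let $Q$ assign to each matroid $M$ (invariantly under isomorphism) a polynomial $Q_M(x,y,a,b)\in\mathbb{Q}[x,y,a,b]$ such that $Q_{M_1\oplus M_2}=Q_{M_1}Q_{M_2}$ for all matroids $M_1,M_2$, $Q$ of the empty matroid is $1$, and for every matroid $M=(E,\mathcal{I})$ and every $e\in E$: if $e$ is a coloop then $Q_M=x\,Q_{M\setminus e}$; if $e$ is a loop then $Q_M=y\,Q_{M/e}$; if $e$ is neither a loop nor a coloop then $Q_M=a\,Q_{M\setminus e}+b\,Q_{M/e}$. Define the linear map $\beta:H\to\mathbb{Q}[x,y,a,b,s]$ by $\beta(M)=s^{|E|}Q_M(x,y,a,b)$. Then for every matroid $M$, $$\frac{d\beta}{ds}(M)=\Big(x\,\beta\ast\delta_{\mathrm{coloop}}+y\,\delta_{\mathrm{loop}}\ast\beta+b\,[\delta_{\mathrm{coloop}},\beta]_\ast-a\,[\delta_{\mathrm{loop}},\beta]_\ast\Big)(M),$$ where $[f,g]_\ast=f\ast g-g\ast f$.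
   Context: A loop of a matroid is an element $e$ with $\{e\}$ a circuit; a coloop is an element contained in every basis. $M\setminus e$ is deletion and $M/e$ contraction of $e$; more generally for $A\subseteq E$, $M|A$ is the restriction to $A$ and $M/A=(M^\star\setminus A)^\star$ the contraction ($M^\star$ the dual matroid). $U_{0,1}$ is the one-element loop matroid, $U_{1,1}$ the one-element coloop matroid. The matroid Hopf algebra $H$ is the $\mathbb{Q}$-vector space with basis isomorphism classes of finite matroids, product direct sum, coproduct $\Delta(M)=\sum_{A\subseteq E}M|A\otimes M/A$, counit $\epsilon(M)=1$ if $E=\emptyset$ and $0$ otherwise. For linear $f,g:H\to\mathbb{Q}[x,y,a,b,s]$, $(f\ast g)(M)=\sum_{A\subseteq E}f(M|A)g(M/A)$. $\delta_{\mathrm{loop}}(M)=1$ if $M\cong U_{0,1}$, else $0$; $\delta_{\mathrm{coloop}}(M)=1$ if $M\cong U_{1,1}$, else $0$. The derivative $d/ds$ is taken coefficientwise. -}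

module Defs where

open import Data.Nat as ℕ using (ℕ; zero; suc; _+_; _<_; _≡ᵇ_)
open import Data.Bool using (Bool; true; false; _∧_; _∨_; not; T; if_then_else_)
open import Data.Vec using (Vec; []; _∷_; lookup; tabulate; take; drop)
open import Data.Fin using (Fin)
open import Data.Fin.Subset using (Subset; _∈_; _∉_; _⊆_; ⁅_⁆; ∁; _∪_; ⊥; ⊤)
open import Data.List as List using (List; []; _∷_; _++_; concatMap; map; foldr; upTo)
open import Data.Bool.ListAction using (all; any)
open import Data.Integer using (+_)
open import Data.Rational as ℚ using (ℚ; 0ℚ; 1ℚ; _/_)
open import Data.Product using (_×_; _,_; ∃; Σ)
open import Relation.Binary.PropositionalEquality using (_≡_)
open import Relation.Nullary using (¬_)
open import Function.Bundles using (_⤖_; Bijection)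

-- Formal (power) series / polynomials in k variables over ℚ,
-- represented by their coefficient function on exponent vectors.

Series : ℕ → Set
Series k = Vec ℕ k → ℚ

_≈_ : ∀ {k} → Series k → Series k → Set
f ≈ g = ∀ m → f m ≡ g m
infix 4 _≈_

IsPoly : ∀ {k} → Series k → Set
IsPoly {k} f = ∃ λ N → ∀ (m : Vec ℕ k) → (∃ λ i → N < lookup m i) → f m ≡ 0ℚ

fromℕℚ : ℕ → ℚ
fromℕℚ n = (+ n) / 1

0ₚ : ∀ {k} → Series k
0ₚ _ = 0ℚ

eqVecᵇ : ∀ {k} → Vec ℕ k → Vec ℕ k → Bool
eqVecᵇ [] [] = true
eqVecᵇ (a ∷ u) (b ∷ v) = (a ≡ᵇ b) ∧ eqVecᵇ u v

zeroVec : ∀ {k} → Vec ℕ k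
zeroVec = tabulate (λ _ → 0)

constₚ : ∀ {k} → ℚ → Series k
constₚ c m = if eqVecᵇ m zeroVec then c else 0ℚ

1ₚ : ∀ {k} → Series k
1ₚ = constₚ 1ℚ

unitVec : ∀ {k} → Fin k → Vec ℕ k
unitVec {suc k} Fin.zero = 1 ∷ zeroVec
unitVec {suc k} (Fin.suc i) = 0 ∷ unitVec i

var : ∀ {k} → Fin k → Series k
var i m = if eqVecᵇ m (unitVec i) then 1ℚ else 0ℚ

_+ₚ_ : ∀ {k} → Series k → Series k → Series k
(f +ₚ g) m = f m ℚ.+ g m

_-ₚ_ : ∀ {k} → Series k → Series k → Series k
(f -ₚ g) m = f m ℚ.- g m

infixl 6 _+ₚ_ _-ₚ_
infixl 7 _*ₚ_

splits : ∀ {k} → Vec ℕ k → List (Vec ℕ k × Vec ℕ k)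
splits [] = ([] , []) ∷ []
splits (e ∷ m) =
  concatMap (λ i → map (λ { (p , q) → (i ∷ p , (e ℕ.∸ i) ∷ q) }) (splits m))
            (upTo (suc e))

sumℚ : List ℚ → ℚ
sumℚ = foldr ℚ._+_ 0ℚ

_*ₚ_ : ∀ {k} → Series k → Series k → Series k
(f *ₚ g) m = sumℚ (map (λ { (p , q) → f p ℚ.* g q }) (splits m))

_^ₚ_ : ∀ {k} → Series k → ℕ → Series k
f ^ₚ zero = 1ₚ
f ^ₚ suc n = f *ₚ (f ^ₚ n)

sumₚ : ∀ {k} → List (Series k) → Series k
sumₚ = foldr _+ₚ_ 0ₚ

-- Variables.  ℚ[x,y,a,b]: exponent vector (x , y , a , b).
-- ℚ[x,y,a,b,s]: exponent vector (s , x , y , a , b)  (s first).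

x₄ y₄ a₄ b₄ : Series 4
x₄ = var Fin.zero
y₄ = var (Fin.suc Fin.zero)
a₄ = var (Fin.suc (Fin.suc Fin.zero))
b₄ = var (Fin.suc (Fin.suc (Fin.suc Fin.zero)))

sv xv yv av bv : Series 5
sv = var Fin.zero
xv = var (Fin.suc Fin.zero)
yv = var (Fin.suc (Fin.suc Fin.zero))
av = var (Fin.suc (Fin.suc (Fin.suc Fin.zero)))
bv = var (Fin.suc (Fin.suc (Fin.suc (Fin.suc Fin.zero))))

ι : Series 4 → Series 5
ι f (zero ∷ m) = f m
ι f (suc _ ∷ m) = 0ℚ

d/ds : Series 5 → Series 5
d/ds f (j ∷ m) = fromℕℚ (suc j) ℚ.* f (suc j ∷ m)

record SetSystem (n : ℕ) : Set where
  constructor mkSS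
  field indep : Subset n → Bool
open SetSystem public

size : ∀ {n} → Subset n → ℕ
size [] = 0
size (true ∷ A) = suc (size A)
size (false ∷ A) = size A

record IsMatroid {n : ℕ} (M : SetSystem n) : Set where
  field
    indep-∅ : T (indep M ⊥)
    indep-⊆ : ∀ S U → S ⊆ U → T (indep M U) → T (indep M S)
    indep-exchange : ∀ S U → T (indep M S) → T (indep M U) → size S < size U →
                     ∃ λ e → e ∈ U × e ∉ S × T (indep M (S ∪ ⁅ e ⁆))

allSubsets : (n : ℕ) → List (Subset n)
allSubsets zero = [] ∷ []
allSubsets (suc n) = map (true ∷_) (allSubsets n) ++ map (false ∷_) (allSubsets n)

subsetᵇ : ∀ {n} → Subset n → Subset n → Bool
subsetᵇ [] [] = true
subsetᵇ (a ∷ S) (b ∷ U) = (not a ∨ b) ∧ subsetᵇ S U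

isBasis : ∀ {n} → SetSystem n → Subset n → Bool
isBasis {n} M B =
  indep M B ∧ all (λ U → not (indep M U ∧ subsetᵇ B U) ∨ subsetᵇ U B) (allSubsets n)

dual : ∀ {n} → SetSystem n → SetSystem n
dual {n} M = mkSS (λ S → any (λ B → isBasis M B ∧ subsetᵇ S (∁ B)) (allSubsets n))

-- the elements of A, in order, identified with Fin (size A)
expand : ∀ {n} (A : Subset n) → Subset (size A) → Subset n
expand [] S = []
expand (true ∷ A) (b ∷ S) = b ∷ expand A S
expand (false ∷ A) S = false ∷ expand A S

restrict : ∀ {n} → SetSystem n → (A : Subset n) → SetSystem (size A)
restrict M A = mkSS (λ S → indep M (expand A S))

-- contraction M/A = (M* \ A)*  (ground set E ∖ A)
contract : ∀ {n} → SetSystem n → (A : Subset n) → SetSystem (size (∁ A))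
contract M A = dual (restrict (dual M) (∁ A))

delete₁ : ∀ {n} → SetSystem n → (e : Fin n) → SetSystem (size (∁ ⁅ e ⁆))
delete₁ M e = restrict M (∁ ⁅ e ⁆)

contract₁ : ∀ {n} → SetSystem n → (e : Fin n) → SetSystem (size (∁ ⁅ e ⁆))
contract₁ M e = contract M ⁅ e ⁆

-- e is a loop: {e} is a circuit (∅ being independent, {e} is dependent)
IsLoop : ∀ {n} → SetSystem n → Fin n → Set
IsLoop M e = T (indep M ⊥) × T (not (indep M ⁅ e ⁆))

IsColoop : ∀ {n} → SetSystem n → Fin n → Set
IsColoop {n} M e = ∀ B → T (isBasis M B) → e ∈ B

_⊕_ : ∀ {n₁ n₂} → SetSystem n₁ → SetSystem n₂ → SetSystem (n₁ + n₂)
_⊕_ {n₁} M₁ M₂ = mkSS (λ S → indep M₁ (take n₁ S) ∧ indep M₂ (drop n₁ S))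

emptyMatroid : SetSystem 0
emptyMatroid = mkSS (λ _ → true)

record Iso {n m : ℕ} (M : SetSystem n) (M' : SetSystem m) : Set where
  field
    bij : Fin n ⤖ Fin m
    preserves : ∀ (S : Subset m) →
      indep M (tabulate (λ i → lookup S (Bijection.to bij i))) ≡ indep M' S

-- Maps on matroids (the linear maps H → ℚ[x,y,a,b,s], given on the basis)

MapH : Set
MapH = ∀ {n} → SetSystem n → Series 5

-- M ≅ U_{0,1}: one element, which is a loop
δloop : MapH
δloop {n} M = if (n ≡ᵇ 1) ∧ indep M ⊥ ∧ not (indep M ⊤) then 1ₚ else 0ₚ

-- M ≅ U_{1,1}: one element, which is independent
δcoloop : MapH
δcoloop {n} M = if (n ≡ᵇ 1) ∧ indep M ⊤ then 1ₚ else 0ₚ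

_⋆_ : MapH → MapH → MapH
(f ⋆ g) {n} M = sumₚ (map (λ A → f (restrict M A) *ₚ g (contract M A)) (allSubsets n))

[_,_]⋆ : MapH → MapH → MapH
[ f , g ]⋆ M = (f ⋆ g) M -ₚ (g ⋆ f) M

β : (∀ {n} → SetSystem n → Series 4) → MapH
β Q {n} M = (sv ^ₚ n) *ₚ ι (Q M)

module Submission where

open import Defs
open import Data.Nat using (ℕ)
open import Data.Fin using (Fin)
open import Data.Product using (_×_)
open import Relation.Nullary using (¬_)

-- Both sides are compared coefficientwise, row j (the exponent of s) at a
-- time.  β(N) has the single nonzero row |N|, so row j of the left-hand side
-- is (j+1)·Q_M when j+1 = |E| and 0 otherwise.  A convolution with δcoloop
-- or δloop only sees the subsets E ∖ e or {e}; hence each of the four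
-- convolutions on the right is a sum over the elements e of Q(M ∖ e) or
-- Q(M / e), selected by whether e is a coloop or a loop, and again only row
-- j+1 = |E| survives.  For every single element the resulting combination is
-- the deletion–contraction recurrence for Q_M (using that M / e and M ∖ e
-- coincide when e is a loop or a coloop), so that row equals |E|·Q_M too.

open import Data.Nat using (zero; suc; _+_; _∸_; _≡ᵇ_; _<_; _≤_; z≤n; s≤s; z<s; s<s)
import Data.Nat.Properties as ℕP
open import Data.Integer as ℤ using (+_)
open import Data.Rational as ℚ using (ℚ; 0ℚ; 1ℚ)
import Data.Rational.Properties as ℚP
import Data.Rational.Unnormalised as ℚᵘ
import Data.Rational.Unnormalised.Properties as ℚᵘP
open import Data.Rational.Solver using (module +-*-Solver)
open import Data.Bool using (Bool; true; false; _∧_; _∨_; not; T; if_then_else_)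
open import Data.Bool.Properties using (T-∧; T-≡; T-not-≡)
open import Data.Empty using (⊥-elim)
open import Data.Product using (_,_; ∃; proj₁; proj₂)
open import Data.Sum using (_⊎_; inj₁; inj₂)
open import Data.Vec using (Vec; []; _∷_; here; there)
open import Data.Vec.Properties using (tabulate∘lookup)
open import Data.Fin.Subset using (Subset; _∈_; _∉_; _⊆_; _⊂_; ⁅_⁆; ∁; _∪_; ⊥; ⊤)
open import Data.Fin.Subset.Properties
  using (_∈?_; _⊂?_; in⊆in; out⊆; drop-∷-⊆; drop-∷-⊂; ⊥⊆; ∉⊥; ∈⊤; x∈p∪q⁺; x∈p∪q⁻; x∈⁅x⁆;
         x∈⁅y⁆⇒x≡y; x∈∁p⇒x∉p; x∉p⇒x∈∁p)
open import Data.List using (List; []; _∷_; _++_; map; concatMap; applyUpTo; upTo)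
import Data.List.Properties as ListP
open import Data.List.Membership.Propositional using (lose) renaming (_∈_ to _∈ₗ_)
open import Data.List.Membership.Propositional.Properties using (∈-map⁺; ∈-++⁺ˡ; ∈-++⁺ʳ)
open import Data.List.Relation.Unary.Any using (here; satisfied; any?)
open import Data.List.Relation.Unary.Any.Properties using (any⁺; any⁻)
import Data.List.Relation.Unary.All as All
open import Data.List.Relation.Unary.All.Properties using (all⁺; all⁻)
open import Relation.Nullary using (yes; no)
open import Relation.Nullary.Decidable using (dec-true; dec-false; T?; _×-dec_)
open import Relation.Binary.PropositionalEquality
open import Function using (_∘_)
open import Function.Bundles using (Equivalence)
open import Function.Construct.Identity using (⤖-id)

open +-*-Solver using (solve; _:+_; _:-_; _:*_; _:=_; con)

when : Bool → ℚ → ℚ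
when b q = if b then q else 0ℚ

sumℚ-++ : ∀ xs ys → sumℚ (xs ++ ys) ≡ sumℚ xs ℚ.+ sumℚ ys
sumℚ-++ []       ys = sym (ℚP.+-identityˡ _)
sumℚ-++ (x ∷ xs) ys = trans (cong (x ℚ.+_) (sumℚ-++ xs ys)) (sym (ℚP.+-assoc x _ _))

sumℚ-map-cong : ∀ {A : Set} {f g : A → ℚ} → (∀ a → f a ≡ g a) →
                ∀ xs → sumℚ (map f xs) ≡ sumℚ (map g xs)
sumℚ-map-cong f≗g xs = cong sumℚ (ListP.map-cong f≗g xs)

sumℚ-zero : ∀ {A : Set} (f : A → ℚ) → (∀ a → f a ≡ 0ℚ) → ∀ xs → sumℚ (map f xs) ≡ 0ℚ
sumℚ-zero f f≡0 []       = refl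
sumℚ-zero f f≡0 (x ∷ xs) rewrite f≡0 x | sumℚ-zero f f≡0 xs = refl

sumℚ-vanish : ∀ n (h : ℕ → ℚ) → (∀ i → i < n → h i ≡ 0ℚ) → sumℚ (applyUpTo h n) ≡ 0ℚ
sumℚ-vanish zero    h _   = refl
sumℚ-vanish (suc n) h h≡0 rewrite h≡0 0 z<s | sumℚ-vanish n (h ∘ suc) (λ i i<n → h≡0 (suc i) (s<s i<n)) =
  ℚP.+-identityˡ 0ℚ

sumℚ-single : ∀ n c (h : ℕ → ℚ) → c < n → (∀ i → i < n → i ≢ c → h i ≡ 0ℚ) →
              sumℚ (applyUpTo h n) ≡ h c
sumℚ-single (suc n) zero    h _ off =
  trans (cong (h 0 ℚ.+_) (sumℚ-vanish n (h ∘ suc) (λ i i<n → off (suc i) (s<s i<n) (λ ()))))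
        (ℚP.+-identityʳ _)
sumℚ-single (suc n) (suc c) h (s<s c<n) off =
  trans (cong (ℚ._+ sumℚ (applyUpTo (h ∘ suc) n)) (off 0 z<s (λ ())))
  (trans (ℚP.+-identityˡ _)
         (sumℚ-single n c (h ∘ suc) c<n (λ i i<n i≢c → off (suc i) (s<s i<n) (i≢c ∘ ℕP.suc-injective))))

sumFin : ∀ n → (Fin n → ℚ) → ℚ
sumFin zero    f = 0ℚ
sumFin (suc n) f = f Fin.zero ℚ.+ sumFin n (f ∘ Fin.suc)

sumFin-cong : ∀ n {f g : Fin n → ℚ} → (∀ e → f e ≡ g e) → sumFin n f ≡ sumFin n g
sumFin-cong zero    f≗g = refl
sumFin-cong (suc n) f≗g = cong₂ ℚ._+_ (f≗g Fin.zero) (sumFin-cong n (f≗g ∘ Fin.suc))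

sumFin-zero : ∀ n (f : Fin n → ℚ) → (∀ e → f e ≡ 0ℚ) → sumFin n f ≡ 0ℚ
sumFin-zero zero    f f≡0 = refl
sumFin-zero (suc n) f f≡0 rewrite f≡0 Fin.zero | sumFin-zero n (f ∘ Fin.suc) (f≡0 ∘ Fin.suc) = refl

sumFin-+ : ∀ n (f g : Fin n → ℚ) → sumFin n (λ e → f e ℚ.+ g e) ≡ sumFin n f ℚ.+ sumFin n g
sumFin-+ zero    f g = refl
sumFin-+ (suc n) f g rewrite sumFin-+ n (f ∘ Fin.suc) (g ∘ Fin.suc) =
  solve 4 (λ a b c d → (a :+ b) :+ (c :+ d) := (a :+ c) :+ (b :+ d)) refl (f Fin.zero) (g Fin.zero) _ _

sumFin-- : ∀ n (f g : Fin n → ℚ) → sumFin n (λ e → f e ℚ.- g e) ≡ sumFin n f ℚ.- sumFin n g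
sumFin-- zero    f g = refl
sumFin-- (suc n) f g rewrite sumFin-- n (f ∘ Fin.suc) (g ∘ Fin.suc) =
  solve 4 (λ a b c d → (a :- b) :+ (c :- d) := (a :+ c) :- (b :+ d)) refl (f Fin.zero) (g Fin.zero) _ _

sumFin-when : ∀ n g (f : Fin n → ℚ) → sumFin n (λ e → when g (f e)) ≡ when g (sumFin n f)
sumFin-when n true  f = refl
sumFin-when n false f = sumFin-zero n _ (λ _ → refl)

fromℕℚ-suc : ∀ n → fromℕℚ (suc n) ≡ 1ℚ ℚ.+ fromℕℚ n
fromℕℚ-suc n = ℚP.toℚᵘ-injective (begin
    ℚ.toℚᵘ (fromℕℚ (suc n))                   ≈⟨ ℚP.toℚᵘ-fromℚᵘ (ℚᵘ.mkℚᵘ (+ suc n) 0) ⟩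
    ℚᵘ.mkℚᵘ (+ suc n) 0                       ≈⟨ ℚᵘ.*≡* (cross n) ⟩
    ℚ.toℚᵘ 1ℚ ℚᵘ.+ ℚᵘ.mkℚᵘ (+ n) 0            ≈⟨ ℚᵘP.+-congʳ (ℚ.toℚᵘ 1ℚ) (ℚP.toℚᵘ-fromℚᵘ (ℚᵘ.mkℚᵘ (+ n) 0)) ⟨
    ℚ.toℚᵘ 1ℚ ℚᵘ.+ ℚ.toℚᵘ (fromℕℚ n)          ≈⟨ ℚP.toℚᵘ-homo-+ 1ℚ (fromℕℚ n) ⟨
    ℚ.toℚᵘ (1ℚ ℚ.+ fromℕℚ n)                   ∎)
  where
  open ℚᵘP.≃-Reasoning
  cross : ∀ n → (+ suc n) ℤ.* ℚᵘ.↧ (ℚ.toℚᵘ 1ℚ ℚᵘ.+ ℚᵘ.mkℚᵘ (+ n) 0)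
              ≡ ℚᵘ.↥ (ℚ.toℚᵘ 1ℚ ℚᵘ.+ ℚᵘ.mkℚᵘ (+ n) 0) ℤ.* ℚᵘ.↧ (ℚᵘ.mkℚᵘ (+ suc n) 0)
  cross zero    = refl
  cross (suc n) rewrite ℕP.*-identityʳ n = cong (λ k → + suc (suc k)) (sym (ℕP.*-identityʳ n))

sumFin-const : ∀ n q → sumFin n (λ _ → q) ≡ fromℕℚ n ℚ.* q
sumFin-const zero    q = sym (ℚP.*-zeroˡ q)
sumFin-const (suc n) q rewrite sumFin-const n q | fromℕℚ-suc n =
  solve 2 (λ q k → q :+ k :* q := (con 1ℚ :+ k) :* q) refl q (fromℕℚ n)

slice : ∀ {k} → Series (suc k) → ℕ → Series k
slice f i m = f (i ∷ m)

*ₚ-cons : ∀ {k} (f g : Series (suc k)) e m →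
          (f *ₚ g) (e ∷ m) ≡ sumℚ (applyUpTo (λ i → (slice f i *ₚ slice g (e ∸ i)) m) (suc e))
*ₚ-cons f g e m = begin
    sumℚ (map term (concatMap pairsAt (upTo (suc e))))
  ≡⟨ sumℚ-concatMap (upTo (suc e)) ⟩
    sumℚ (map (λ i → sumℚ (map term (pairsAt i))) (upTo (suc e)))
  ≡⟨ sumℚ-map-cong (λ i → cong sumℚ (sym (ListP.map-∘ (splits m)))) (upTo (suc e)) ⟩
    sumℚ (map (λ i → (slice f i *ₚ slice g (e ∸ i)) m) (upTo (suc e)))
  ≡⟨ cong sumℚ (ListP.map-applyUpTo (λ i → i) (λ i → (slice f i *ₚ slice g (e ∸ i)) m) (suc e)) ⟩
    sumℚ (applyUpTo (λ i → (slice f i *ₚ slice g (e ∸ i)) m) (suc e))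
  ∎
  where
  open ≡-Reasoning
  term : Vec ℕ _ × Vec ℕ _ → ℚ
  term (p , q) = f p ℚ.* g q
  pairsAt : ℕ → List (Vec ℕ _ × Vec ℕ _)
  pairsAt i = map (λ { (p , q) → (i ∷ p , (e ∸ i) ∷ q) }) (splits m)
  sumℚ-concatMap : ∀ is → sumℚ (map term (concatMap pairsAt is))
                            ≡ sumℚ (map (λ i → sumℚ (map term (pairsAt i))) is)
  sumℚ-concatMap []       = refl
  sumℚ-concatMap (i ∷ is) =
    trans (cong sumℚ (ListP.map-++ term (pairsAt i) (concatMap pairsAt is)))
    (trans (sumℚ-++ (map term (pairsAt i)) _)
           (cong (sumℚ (map term (pairsAt i)) ℚ.+_) (sumℚ-concatMap is)))

*ₚ-congˡ : ∀ {k} {f f' : Series k} (g : Series k) → f ≈ f' → f *ₚ g ≈ f' *ₚ g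
*ₚ-congˡ g f≈f' m = sumℚ-map-cong (λ { (p , q) → cong (ℚ._* g q) (f≈f' p) }) (splits m)

*ₚ-congʳ : ∀ {k} (f : Series k) {g g' : Series k} → g ≈ g' → f *ₚ g ≈ f *ₚ g'
*ₚ-congʳ f g≈g' m = sumℚ-map-cong (λ { (p , q) → cong (f p ℚ.*_) (g≈g' q) }) (splits m)

*ₚ-zeroˡ : ∀ {k} {f : Series k} (g : Series k) → f ≈ 0ₚ → f *ₚ g ≈ 0ₚ
*ₚ-zeroˡ {f = f} g f≈0 m =
  sumℚ-zero _ (λ { (p , q) → trans (cong (ℚ._* g q) (f≈0 p)) (ℚP.*-zeroˡ (g q)) }) (splits m)

*ₚ-zeroʳ : ∀ {k} (f : Series k) {g : Series k} → g ≈ 0ₚ → f *ₚ g ≈ 0ₚ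
*ₚ-zeroʳ f {g} g≈0 m =
  sumℚ-zero _ (λ { (p , q) → trans (cong (f p ℚ.*_) (g≈0 q)) (ℚP.*-zeroʳ (f p)) }) (splits m)

module SingleRow {k} (f g : Series (suc k)) (c : ℕ) (off : ∀ i → i ≢ c → slice f i ≈ 0ₚ) where

  *ₚ-row : ∀ e m → c ≤ e → (f *ₚ g) (e ∷ m) ≡ (slice f c *ₚ slice g (e ∸ c)) m
  *ₚ-row e m c≤e = trans (*ₚ-cons f g e m)
    (sumℚ-single (suc e) c _ (s≤s c≤e) (λ i _ i≢c → *ₚ-zeroˡ (slice g (e ∸ i)) (off i i≢c) m))

  *ₚ-row-vanish : ∀ e m → e < c → (f *ₚ g) (e ∷ m) ≡ 0ℚ
  *ₚ-row-vanish e m e<c = trans (*ₚ-cons f g e m)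
    (sumℚ-vanish (suc e) _ (λ i i≤e → *ₚ-zeroˡ (slice g (e ∸ i))
      (off i (λ { refl → ℕP.<-irrefl refl (ℕP.<-≤-trans e<c (ℕP.m<1+n⇒m≤n i≤e)) })) m))

1ₚ-off : ∀ {k} i → i ≢ 0 → slice (1ₚ {suc k}) i ≈ 0ₚ
1ₚ-off zero    0≢0 _ = ⊥-elim (0≢0 refl)
1ₚ-off (suc i) _   _ = refl

*ₚ-identityˡ : ∀ {k} (g : Series k) → 1ₚ *ₚ g ≈ g
*ₚ-identityˡ {zero}  g [] = trans (ℚP.+-identityʳ _) (ℚP.*-identityˡ _)
*ₚ-identityˡ {suc k} g (e ∷ m) =
  trans (SingleRow.*ₚ-row 1ₚ g 0 1ₚ-off e m z≤n) (*ₚ-identityˡ (slice g e) m)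

*ₚ-identityʳ : ∀ {k} (g : Series k) → g *ₚ 1ₚ ≈ g
*ₚ-identityʳ {zero}  g [] = trans (ℚP.+-identityʳ _) (ℚP.*-identityʳ _)
*ₚ-identityʳ {suc k} g (e ∷ m) =
  trans (*ₚ-cons g 1ₚ e m)
  (trans (sumℚ-single (suc e) e _ (ℕP.n<1+n e)
            (λ i i≤e i≢e → *ₚ-zeroʳ (slice g i) (1ₚ-off (e ∸ i) (i≢e ∘ ∸≡0 i≤e)) m))
  (trans (*ₚ-congʳ (slice g e) (λ q → cong (λ j → 1ₚ (j ∷ q)) (ℕP.n∸n≡0 e)) m)
         (*ₚ-identityʳ (slice g e) m)))
  where
  ∸≡0 : ∀ {i} → i < suc e → e ∸ i ≡ 0 → i ≡ e
  ∸≡0 i≤e e∸i≡0 = ℕP.≤-antisym (ℕP.m<1+n⇒m≤n i≤e) (ℕP.m∸n≡0⇒m≤n e∸i≡0)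

timesVar : ∀ {k} → Fin k → Series k → Series k
timesVar Fin.zero    g (zero ∷ m)  = 0ℚ
timesVar Fin.zero    g (suc e ∷ m) = g (e ∷ m)
timesVar (Fin.suc i) g (e ∷ m)     = timesVar i (slice g e) m

var₀-off : ∀ {k} i → i ≢ 1 → slice (var {suc k} Fin.zero) i ≈ 0ₚ
var₀-off zero          _   _ = refl
var₀-off (suc zero)    1≢1 _ = ⊥-elim (1≢1 refl)
var₀-off (suc (suc i)) _   _ = refl

varₛ-off : ∀ {k} (i : Fin k) j → j ≢ 0 → slice (var (Fin.suc i)) j ≈ 0ₚ
varₛ-off i zero    0≢0 _ = ⊥-elim (0≢0 refl)
varₛ-off i (suc j) _   _ = refl

var-*ₚ : ∀ {k} (i : Fin k) (g : Series k) → var i *ₚ g ≈ timesVar i g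
var-*ₚ Fin.zero    g (zero ∷ m)  = SingleRow.*ₚ-row-vanish (var Fin.zero) g 1 var₀-off 0 m z<s
var-*ₚ Fin.zero    g (suc e ∷ m) =
  trans (SingleRow.*ₚ-row (var Fin.zero) g 1 var₀-off (suc e) m (s≤s z≤n)) (*ₚ-identityˡ (slice g e) m)
var-*ₚ (Fin.suc i) g (e ∷ m) =
  trans (SingleRow.*ₚ-row (var (Fin.suc i)) g 0 (varₛ-off i) e m z≤n) (var-*ₚ i (slice g e) m)

sPow-slice : ∀ n i → slice (sv ^ₚ n) i ≈ (if i ≡ᵇ n then 1ₚ else 0ₚ)
sPow-slice zero    zero    p = refl
sPow-slice zero    (suc i) p = refl
sPow-slice (suc n) i       p = trans (var-*ₚ Fin.zero (sv ^ₚ n) (i ∷ p)) (lowered i)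
  where
  lowered : ∀ i → timesVar Fin.zero (sv ^ₚ n) (i ∷ p) ≡ (if i ≡ᵇ suc n then 1ₚ else 0ₚ) p
  lowered zero    = refl
  lowered (suc i) = sPow-slice n i p

sPow-off : ∀ n i → i ≢ n → slice (sv ^ₚ n) i ≈ 0ₚ
sPow-off n i i≢n p = trans (sPow-slice n i p) (cong (λ b → (if b then 1ₚ else 0ₚ) p) (dec-false (i ℕP.≟ n) i≢n))

sPow-rowₙ : ∀ n → slice (sv ^ₚ n) n ≈ 1ₚ
sPow-rowₙ n p = trans (sPow-slice n n p) (cong (λ b → (if b then 1ₚ else 0ₚ) p) (dec-true (n ℕP.≟ n) refl))

ι-row : ∀ (F : Series 4) {n e} → n ≤ e → ∀ m → ι F ((e ∸ n) ∷ m) ≡ when (e ≡ᵇ n) (F m)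
ι-row F {e = zero}  z≤n       m = refl
ι-row F {e = suc e} z≤n       m = refl
ι-row F             (s≤s n≤e) m = ι-row F n≤e m

sPow-*ₚ-ι : ∀ n (F : Series 4) e m → ((sv ^ₚ n) *ₚ ι F) (e ∷ m) ≡ when (e ≡ᵇ n) (F m)
sPow-*ₚ-ι n F e m with n ℕP.≤? e
... | yes n≤e = begin
    ((sv ^ₚ n) *ₚ ι F) (e ∷ m)                     ≡⟨ *ₚ-row e m n≤e ⟩
    (slice (sv ^ₚ n) n *ₚ slice (ι F) (e ∸ n)) m   ≡⟨ *ₚ-congˡ (slice (ι F) (e ∸ n)) (sPow-rowₙ n) m ⟩
    (1ₚ *ₚ slice (ι F) (e ∸ n)) m                  ≡⟨ *ₚ-identityˡ (slice (ι F) (e ∸ n)) m ⟩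
    ι F ((e ∸ n) ∷ m)                              ≡⟨ ι-row F n≤e m ⟩
    when (e ≡ᵇ n) (F m)                            ∎
  where
  open ≡-Reasoning
  open SingleRow (sv ^ₚ n) (ι F) n (sPow-off n)
... | no n≰e = trans (SingleRow.*ₚ-row-vanish (sv ^ₚ n) (ι F) n (sPow-off n) e m (ℕP.≰⇒> n≰e))
                     (cong (λ b → when b (F m)) (sym (dec-false (e ℕP.≟ n) (λ { refl → n≰e ℕP.≤-refl }))))

β-row : ∀ (Q : ∀ {n} → SetSystem n → Series 4) {k} (N : SetSystem k) j v →
        β Q N (j ∷ v) ≡ when (j ≡ᵇ k) (Q N v)
β-row Q {k} N j v = sPow-*ₚ-ι k (Q N) j v

timesVar-cong : ∀ {k} (i : Fin k) {F G : Series k} → F ≈ G → timesVar i F ≈ timesVar i G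
timesVar-cong Fin.zero    F≈G (zero ∷ m)  = refl
timesVar-cong Fin.zero    F≈G (suc e ∷ m) = F≈G (e ∷ m)
timesVar-cong (Fin.suc i) F≈G (e ∷ m)     = timesVar-cong i (F≈G ∘ (e ∷_)) m

timesVar-when : ∀ {k} (i : Fin k) b (F : Series k) m →
                timesVar i (λ v → when b (F v)) m ≡ when b (timesVar i F m)
timesVar-when Fin.zero    true  F (zero ∷ m)  = refl
timesVar-when Fin.zero    false F (zero ∷ m)  = refl
timesVar-when Fin.zero    b     F (suc e ∷ m) = refl
timesVar-when (Fin.suc i) b     F (e ∷ m)     = timesVar-when i b (slice F e) m

timesVar-sumFin : ∀ {k} (i : Fin k) n (F : Fin n → Series k) m →
                  timesVar i (λ v → sumFin n (λ e → F e v)) m ≡ sumFin n (λ e → timesVar i (F e) m)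
timesVar-sumFin Fin.zero    n F (zero ∷ m)  = sym (sumFin-zero n _ (λ _ → refl))
timesVar-sumFin Fin.zero    n F (suc x ∷ m) = refl
timesVar-sumFin (Fin.suc i) n F (x ∷ m)     = timesVar-sumFin i n (λ e → slice (F e) x) m

timesVar-- : ∀ {k} (i : Fin k) (F G : Series k) → timesVar i (F -ₚ G) ≈ timesVar i F -ₚ timesVar i G
timesVar-- Fin.zero    F G (zero ∷ m)  = refl
timesVar-- Fin.zero    F G (suc x ∷ m) = refl
timesVar-- (Fin.suc i) F G (x ∷ m)     = timesVar-- i (slice F x) (slice G x) m

sumSubsets : ∀ n → (Subset n → ℚ) → ℚ
sumSubsets n F = sumℚ (map F (allSubsets n))

sumSubsets-suc : ∀ n (F : Subset (suc n) → ℚ) →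
  sumSubsets (suc n) F ≡ sumSubsets n (F ∘ (true ∷_)) ℚ.+ sumSubsets n (F ∘ (false ∷_))
sumSubsets-suc n F =
  trans (cong sumℚ (ListP.map-++ F (map (true ∷_) (allSubsets n)) (map (false ∷_) (allSubsets n))))
  (trans (sumℚ-++ (map F (map (true ∷_) (allSubsets n))) _)
         (sym (cong₂ ℚ._+_ (cong sumℚ (ListP.map-∘ (allSubsets n)))
                           (cong sumℚ (ListP.map-∘ (allSubsets n))))))

sumSubsets-empty : ∀ n (F : Subset n → ℚ) → (∀ A → (size A ≡ᵇ 0) ≡ false → F A ≡ 0ℚ) →
                   sumSubsets n F ≡ F ⊥
sumSubsets-empty zero    F off = ℚP.+-identityʳ _
sumSubsets-empty (suc n) F off = begin
    sumSubsets (suc n) F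
  ≡⟨ sumSubsets-suc n F ⟩
    sumSubsets n (F ∘ (true ∷_)) ℚ.+ sumSubsets n (F ∘ (false ∷_))
  ≡⟨ cong₂ ℚ._+_ (sumℚ-zero _ (λ A → off (true ∷ A) refl) (allSubsets n))
                 (sumSubsets-empty n (F ∘ (false ∷_)) (off ∘ (false ∷_))) ⟩
    0ℚ ℚ.+ F ⊥
  ≡⟨ ℚP.+-identityˡ _ ⟩
    F ⊥
  ∎
  where open ≡-Reasoning

sumSubsets-full : ∀ n (F : Subset n → ℚ) → (∀ A → (size (∁ A) ≡ᵇ 0) ≡ false → F A ≡ 0ℚ) →
                  sumSubsets n F ≡ F ⊤
sumSubsets-full zero    F off = ℚP.+-identityʳ _
sumSubsets-full (suc n) F off = begin
    sumSubsets (suc n) F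
  ≡⟨ sumSubsets-suc n F ⟩
    sumSubsets n (F ∘ (true ∷_)) ℚ.+ sumSubsets n (F ∘ (false ∷_))
  ≡⟨ cong₂ ℚ._+_ (sumSubsets-full n (F ∘ (true ∷_)) (off ∘ (true ∷_)))
                 (sumℚ-zero _ (λ A → off (false ∷ A) refl) (allSubsets n)) ⟩
    F ⊤ ℚ.+ 0ℚ
  ≡⟨ ℚP.+-identityʳ _ ⟩
    F ⊤
  ∎
  where open ≡-Reasoning

sumSubsets-singletons : ∀ n (F : Subset n → ℚ) → (∀ A → (size A ≡ᵇ 1) ≡ false → F A ≡ 0ℚ) →
                        sumSubsets n F ≡ sumFin n (λ e → F ⁅ e ⁆)
sumSubsets-singletons zero    F off = trans (ℚP.+-identityʳ _) (off [] refl)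
sumSubsets-singletons (suc n) F off =
  trans (sumSubsets-suc n F)
        (cong₂ ℚ._+_ (sumSubsets-empty n (F ∘ (true ∷_)) (off ∘ (true ∷_)))
                     (sumSubsets-singletons n (F ∘ (false ∷_)) (off ∘ (false ∷_))))

∁⊥≡⊤ : ∀ {n} → ∁ (⊥ {n}) ≡ ⊤
∁⊥≡⊤ {zero}  = refl
∁⊥≡⊤ {suc n} = cong (true ∷_) ∁⊥≡⊤

sumSubsets-cosingletons : ∀ n (F : Subset n → ℚ) → (∀ A → (size (∁ A) ≡ᵇ 1) ≡ false → F A ≡ 0ℚ) →
                          sumSubsets n F ≡ sumFin n (λ e → F (∁ ⁅ e ⁆))
sumSubsets-cosingletons zero    F off = trans (ℚP.+-identityʳ _) (off [] refl)
sumSubsets-cosingletons (suc n) F off = begin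
    sumSubsets (suc n) F
  ≡⟨ sumSubsets-suc n F ⟩
    sumSubsets n (F ∘ (true ∷_)) ℚ.+ sumSubsets n (F ∘ (false ∷_))
  ≡⟨ cong₂ ℚ._+_ (sumSubsets-cosingletons n (F ∘ (true ∷_)) (off ∘ (true ∷_)))
                 (sumSubsets-full n (F ∘ (false ∷_)) (off ∘ (false ∷_))) ⟩
    sumFin n (λ e → F (true ∷ ∁ ⁅ e ⁆)) ℚ.+ F (false ∷ ⊤)
  ≡⟨ ℚP.+-comm (sumFin n (λ e → F (true ∷ ∁ ⁅ e ⁆))) (F (false ∷ ⊤)) ⟩
    F (false ∷ ⊤) ℚ.+ sumFin n (λ e → F (true ∷ ∁ ⁅ e ⁆))
  ≡⟨ cong (λ A → F (false ∷ A) ℚ.+ sumFin n (λ e → F (true ∷ ∁ ⁅ e ⁆))) (sym ∁⊥≡⊤) ⟩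
    sumFin (suc n) (λ e → F (∁ ⁅ e ⁆))
  ∎
  where open ≡-Reasoning

-- Both are indicator functions of
-- one-element matroids passing a Boolean test, so a convolution with them
-- only sees the subsets A = E ∖ e (on the right) or A = {e} (on the left).

δ[_] : (∀ {n} → SetSystem n → Bool) → MapH
δ[ P ] {n} N = if (n ≡ᵇ 1) ∧ P N then 1ₚ else 0ₚ

isColoopMatroid isLoopMatroid : ∀ {n} → SetSystem n → Bool
isColoopMatroid N = indep N ⊤
isLoopMatroid   N = indep N ⊥ ∧ not (indep N ⊤)

sumₚ-apply : ∀ {k} {A : Set} (G : A → Series k) xs w → sumₚ (map G xs) w ≡ sumℚ (map (λ a → G a w) xs)
sumₚ-apply G []       w = refl
sumₚ-apply G (x ∷ xs) w = cong (G x w ℚ.+_) (sumₚ-apply G xs w)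

*ₚ-indicatorʳ : ∀ {k} (f : Series k) b w → (f *ₚ (if b then 1ₚ else 0ₚ)) w ≡ when b (f w)
*ₚ-indicatorʳ f true  w = *ₚ-identityʳ f w
*ₚ-indicatorʳ f false w = *ₚ-zeroʳ f (λ _ → refl) w

*ₚ-indicatorˡ : ∀ {k} (f : Series k) b w → ((if b then 1ₚ else 0ₚ) *ₚ f) w ≡ when b (f w)
*ₚ-indicatorˡ f true  w = *ₚ-identityˡ f w
*ₚ-indicatorˡ f false w = *ₚ-zeroˡ f (λ _ → refl) w

∁-involutive : ∀ {n} (A : Subset n) → ∁ (∁ A) ≡ A
∁-involutive []          = refl
∁-involutive (true ∷ A)  = cong (true ∷_) (∁-involutive A)
∁-involutive (false ∷ A) = cong (false ∷_) (∁-involutive A)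

size-⊥ : ∀ {n} → size (⊥ {n}) ≡ 0
size-⊥ {zero}  = refl
size-⊥ {suc n} = size-⊥ {n}

size-⁅⁆ : ∀ {n} (e : Fin n) → size ⁅ e ⁆ ≡ 1
size-⁅⁆ {suc n} Fin.zero    = cong suc (size-⊥ {n})
size-⁅⁆         (Fin.suc e) = size-⁅⁆ e

is1-⁅⁆ : ∀ {n} (e : Fin n) → (size ⁅ e ⁆ ≡ᵇ 1) ≡ true
is1-⁅⁆ e rewrite size-⁅⁆ e = refl

is1-∁∁⁅⁆ : ∀ {n} (e : Fin n) → (size (∁ (∁ ⁅ e ⁆)) ≡ᵇ 1) ≡ true
is1-∁∁⁅⁆ e rewrite ∁-involutive ⁅ e ⁆ = is1-⁅⁆ e

⋆δ-apply : ∀ (f : MapH) (P : ∀ {n} → SetSystem n → Bool) {n} (M : SetSystem n) w →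
  (f ⋆ δ[ P ]) M w ≡ sumFin n (λ e → when (P (contract M (∁ ⁅ e ⁆))) (f (delete₁ M e) w))
⋆δ-apply f P {n} M w =
  trans (sumₚ-apply (λ A → f (restrict M A) *ₚ δ[ P ] (contract M A)) (allSubsets n) w)
  (trans (sumSubsets-cosingletons n _ off) (sumFin-cong n term))
  where
  off : ∀ A → (size (∁ A) ≡ᵇ 1) ≡ false → (f (restrict M A) *ₚ δ[ P ] (contract M A)) w ≡ 0ℚ
  off A ≢1 = trans (*ₚ-indicatorʳ (f (restrict M A)) _ w)
                   (cong (λ b → when (b ∧ P (contract M A)) (f (restrict M A) w)) ≢1)
  term : ∀ e → (f (delete₁ M e) *ₚ δ[ P ] (contract M (∁ ⁅ e ⁆))) w
               ≡ when (P (contract M (∁ ⁅ e ⁆))) (f (delete₁ M e) w)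
  term e = trans (*ₚ-indicatorʳ (f (delete₁ M e)) _ w)
                 (cong (λ b → when (b ∧ P (contract M (∁ ⁅ e ⁆))) (f (delete₁ M e) w)) (is1-∁∁⁅⁆ e))

δ⋆-apply : ∀ (P : ∀ {n} → SetSystem n → Bool) (f : MapH) {n} (M : SetSystem n) w →
  (δ[ P ] ⋆ f) M w ≡ sumFin n (λ e → when (P (restrict M ⁅ e ⁆)) (f (contract₁ M e) w))
δ⋆-apply P f {n} M w =
  trans (sumₚ-apply (λ A → δ[ P ] (restrict M A) *ₚ f (contract M A)) (allSubsets n) w)
  (trans (sumSubsets-singletons n _ off) (sumFin-cong n term))
  where
  off : ∀ A → (size A ≡ᵇ 1) ≡ false → (δ[ P ] (restrict M A) *ₚ f (contract M A)) w ≡ 0ℚ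
  off A ≢1 = trans (*ₚ-indicatorˡ (f (contract M A)) _ w)
                   (cong (λ b → when (b ∧ P (restrict M A)) (f (contract M A) w)) ≢1)
  term : ∀ e → (δ[ P ] (restrict M ⁅ e ⁆) *ₚ f (contract₁ M e)) w
               ≡ when (P (restrict M ⁅ e ⁆)) (f (contract₁ M e) w)
  term e = trans (*ₚ-indicatorˡ (f (contract₁ M e)) _ w)
                 (cong (λ b → when (b ∧ P (restrict M ⁅ e ⁆)) (f (contract₁ M e) w)) (is1-⁅⁆ e))

∈-allSubsets : ∀ {n} (S : Subset n) → S ∈ₗ allSubsets n
∈-allSubsets []          = here refl
∈-allSubsets {suc n} (true ∷ S)  = ∈-++⁺ˡ (∈-map⁺ (true ∷_) (∈-allSubsets S))
∈-allSubsets {suc n} (false ∷ S) = ∈-++⁺ʳ (map (true ∷_) (allSubsets n)) (∈-map⁺ (false ∷_) (∈-allSubsets S))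

subsetᵇ⇒⊆ : ∀ {n} (S U : Subset n) → T (subsetᵇ S U) → S ⊆ U
subsetᵇ⇒⊆ []          []          _ ()
subsetᵇ⇒⊆ (true ∷ S)  (true ∷ U)  h = in⊆in (subsetᵇ⇒⊆ S U h)
subsetᵇ⇒⊆ (false ∷ S) (b ∷ U)     h = out⊆ (subsetᵇ⇒⊆ S U h)

⊆⇒subsetᵇ : ∀ {n} (S U : Subset n) → S ⊆ U → T (subsetᵇ S U)
⊆⇒subsetᵇ []          []          _   = _
⊆⇒subsetᵇ (true ∷ S)  (true ∷ U)  S⊆U = ⊆⇒subsetᵇ S U (drop-∷-⊆ S⊆U)
⊆⇒subsetᵇ (true ∷ S)  (false ∷ U) S⊆U with S⊆U here
... | ()
⊆⇒subsetᵇ (false ∷ S) (b ∷ U)     S⊆U = ⊆⇒subsetᵇ S U (drop-∷-⊆ S⊆U)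

IsBasis : ∀ {n} → SetSystem n → Subset n → Set
IsBasis N B = T (indep N B) × (∀ U → T (indep N U) → B ⊆ U → U ⊆ B)

isBasis-sound : ∀ {n} (N : SetSystem n) B → T (isBasis N B) → IsBasis N B
isBasis-sound {n} N B h = iB , maximal
  where
  iB = proj₁ (Equivalence.to T-∧ h)
  maximal : ∀ U → T (indep N U) → B ⊆ U → U ⊆ B
  maximal U iU B⊆U = subsetᵇ⇒⊆ U B (modusPonens (indep N U ∧ subsetᵇ B U)
    (Equivalence.from T-∧ (iU , ⊆⇒subsetᵇ B U B⊆U))
    (All.lookup (all⁺ _ (allSubsets n) (proj₂ (Equivalence.to T-∧ h))) (∈-allSubsets U)))
    where
    modusPonens : ∀ c {d} → T c → T (not c ∨ d) → T d
    modusPonens true _ d = d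

isBasis-complete : ∀ {n} (N : SetSystem n) B → IsBasis N B → T (isBasis N B)
isBasis-complete {n} N B (iB , maximal) =
  Equivalence.from T-∧ (iB , all⁻ _ {allSubsets n} (All.tabulate (λ {U} _ → implication U)))
  where
  implication : ∀ U → T (not (indep N U ∧ subsetᵇ B U) ∨ subsetᵇ U B)
  implication U with indep N U in iU | subsetᵇ B U in B⊆U
  ... | false | _     = _
  ... | true  | false = _
  ... | true  | true  = ⊆⇒subsetᵇ U B (maximal U (Equivalence.from T-≡ iU)
                                                  (subsetᵇ⇒⊆ B U (Equivalence.from T-≡ B⊆U)))

dual-indep⁻ : ∀ {n} (N : SetSystem n) S → T (indep (dual N) S) → ∃ λ B → IsBasis N B × S ⊆ ∁ B
dual-indep⁻ {n} N S h with satisfied (any⁻ _ (allSubsets n) h)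
... | B , hB = let bB , S⊆∁B = Equivalence.to T-∧ hB
               in B , isBasis-sound N B bB , subsetᵇ⇒⊆ S (∁ B) S⊆∁B

dual-indep⁺ : ∀ {n} (N : SetSystem n) {S B} → IsBasis N B → S ⊆ ∁ B → T (indep (dual N) S)
dual-indep⁺ {n} N {S} {B} bB S⊆∁B = any⁺ _ (lose (∈-allSubsets B)
  (Equivalence.from T-∧ (isBasis-complete N B bB , ⊆⇒subsetᵇ S (∁ B) S⊆∁B)))

size-≤ : ∀ {n} (S : Subset n) → size S ≤ n
size-≤ []          = z≤n
size-≤ (true ∷ S)  = s≤s (size-≤ S)
size-≤ (false ∷ S) = ℕP.m≤n⇒m≤1+n (size-≤ S)

size-⊆ : ∀ {n} {S U : Subset n} → S ⊆ U → size S ≤ size U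
size-⊆ {S = []}        {[]}        _   = z≤n
size-⊆ {S = true ∷ S}  {true ∷ U}  S⊆U = s≤s (size-⊆ (drop-∷-⊆ S⊆U))
size-⊆ {S = true ∷ S}  {false ∷ U} S⊆U with S⊆U here
... | ()
size-⊆ {S = false ∷ S} {true ∷ U}  S⊆U = ℕP.m≤n⇒m≤1+n (size-⊆ (drop-∷-⊆ S⊆U))
size-⊆ {S = false ∷ S} {false ∷ U} S⊆U = size-⊆ (drop-∷-⊆ S⊆U)

size-⊂ : ∀ {n} {S U : Subset n} → S ⊂ U → size S < size U
size-⊂ {S = true ∷ S}  {true ∷ U}  S⊂U = s≤s (size-⊂ (drop-∷-⊂ S⊂U))
size-⊂ {S = true ∷ S}  {false ∷ U} (S⊆U , _) with S⊆U here
... | ()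
size-⊂ {S = false ∷ S} {true ∷ U}  (S⊆U , _) = s≤s (size-⊆ (drop-∷-⊆ S⊆U))
size-⊂ {S = false ∷ S} {false ∷ U} S⊂U = size-⊂ (drop-∷-⊂ S⊂U)

basis-or-grow : ∀ {n} (N : SetSystem n) S → T (indep N S) →
                IsBasis N S ⊎ ∃ λ U → T (indep N U) × S ⊂ U
basis-or-grow {n} N S iS with any? (λ U → T? (indep N U) ×-dec S ⊂? U) (allSubsets n)
... | yes larger = inj₂ (satisfied larger)
... | no  none   = inj₁ (iS , maximal)
  where
  maximal : ∀ U → T (indep N U) → S ⊆ U → U ⊆ S
  maximal U iU S⊆U {x} x∈U with x ∈? S
  ... | yes x∈S = x∈S
  ... | no  x∉S = ⊥-elim (none (lose (∈-allSubsets U) (iU , S⊆U , x , x∈U , x∉S)))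

-- every independent set extends to a basis; the fuel f bounds the number of
-- enlargements, since n ≤ size S + f and each enlargement increases the size
extend-to-basis : ∀ {n} (N : SetSystem n) f S → n ≤ size S + f → T (indep N S) →
                  ∃ λ B → IsBasis N B × S ⊆ B
extend-to-basis N f S bound iS with basis-or-grow N S iS
... | inj₁ bS = S , bS , λ x∈S → x∈S
extend-to-basis {n} N zero    S bound iS | inj₂ (U , _ , S⊂U) =
  ⊥-elim (ℕP.<-irrefl refl (ℕP.≤-<-trans (ℕP.≤-trans bound (ℕP.≤-reflexive (ℕP.+-identityʳ (size S))))
                                         (ℕP.<-≤-trans (size-⊂ S⊂U) (size-≤ U))))
extend-to-basis {n} N (suc f) S bound iS | inj₂ (U , iU , S⊂U) =
  let B , bB , U⊆B = extend-to-basis N f U bound′ iU in B , bB , U⊆B ∘ proj₁ S⊂U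
  where
  bound′ : n ≤ size U + f
  bound′ = ℕP.≤-trans bound (ℕP.≤-trans (ℕP.≤-reflexive (ℕP.+-suc (size S) f))
                                        (ℕP.+-monoˡ-≤ f (size-⊂ S⊂U)))

basis-extension : ∀ {n} (N : SetSystem n) S → T (indep N S) → ∃ λ B → IsBasis N B × S ⊆ B
basis-extension {n} N S = extend-to-basis N n S (ℕP.m≤n+m n (size S))

dual-∅ : ∀ {n} (N : SetSystem n) → T (indep N ⊥) → T (indep (dual N) ⊥)
dual-∅ N i∅ = let B , bB , _ = basis-extension N ⊥ i∅ in dual-indep⁺ N bB ⊥⊆

emb : ∀ {n} (A : Subset n) → Fin (size A) → Fin n
emb (true ∷ A)  Fin.zero    = Fin.zero
emb (true ∷ A)  (Fin.suc y) = Fin.suc (emb A y)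
emb (false ∷ A) y           = Fin.suc (emb A y)

compress : ∀ {n} (A : Subset n) → Subset n → Subset (size A)
compress []          []      = []
compress (true ∷ A)  (w ∷ W) = w ∷ compress A W
compress (false ∷ A) (w ∷ W) = compress A W

emb-∈ : ∀ {n} (A : Subset n) y → emb A y ∈ A
emb-∈ (true ∷ A)  Fin.zero    = here
emb-∈ (true ∷ A)  (Fin.suc y) = there (emb-∈ A y)
emb-∈ (false ∷ A) y           = there (emb-∈ A y)

∈⇒emb : ∀ {n} (A : Subset n) {x} → x ∈ A → ∃ λ y → emb A y ≡ x
∈⇒emb (true ∷ A)  here      = Fin.zero , refl
∈⇒emb (true ∷ A)  (there p) = let y , eq = ∈⇒emb A p in Fin.suc y , cong Fin.suc eq
∈⇒emb (false ∷ A) (there p) = let y , eq = ∈⇒emb A p in y , cong Fin.suc eq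

expand-∈⁺ : ∀ {n} (A : Subset n) {S y} → y ∈ S → emb A y ∈ expand A S
expand-∈⁺ (true ∷ A)  here      = here
expand-∈⁺ (true ∷ A)  (there p) = there (expand-∈⁺ A p)
expand-∈⁺ (false ∷ A) p         = there (expand-∈⁺ A p)

expand-∈⁻ : ∀ {n} (A : Subset n) {S x} → x ∈ expand A S → ∃ λ y → y ∈ S × emb A y ≡ x
expand-∈⁻ (true ∷ A)  {true ∷ S}  here      = Fin.zero , here , refl
expand-∈⁻ (true ∷ A)  {b ∷ S}     (there p) =
  let y , y∈S , eq = expand-∈⁻ A p in Fin.suc y , there y∈S , cong Fin.suc eq
expand-∈⁻ (false ∷ A)             (there p) =
  let y , y∈S , eq = expand-∈⁻ A p in y , y∈S , cong Fin.suc eq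

compress-∈⁺ : ∀ {n} (A : Subset n) {W} y → emb A y ∈ W → y ∈ compress A W
compress-∈⁺ (true ∷ A)  {true ∷ W} Fin.zero    here      = here
compress-∈⁺ (true ∷ A)  {w ∷ W}    (Fin.suc y) (there p) = there (compress-∈⁺ A y p)
compress-∈⁺ (false ∷ A) {w ∷ W}    y           (there p) = compress-∈⁺ A y p

compress-∈⁻ : ∀ {n} (A : Subset n) {W} y → y ∈ compress A W → emb A y ∈ W
compress-∈⁻ (true ∷ A)  {true ∷ W} Fin.zero    here      = here
compress-∈⁻ (true ∷ A)  {w ∷ W}    (Fin.suc y) (there p) = there (compress-∈⁻ A y p)
compress-∈⁻ (false ∷ A) {w ∷ W}    y           p         = there (compress-∈⁻ A y p)

expand-compress : ∀ {n} (A W : Subset n) → expand A (compress A W) ⊆ W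
expand-compress A W x∈ with expand-∈⁻ A x∈
... | y , y∈ , refl = compress-∈⁻ A y y∈

expand-mono : ∀ {n} (A : Subset n) {S U} → S ⊆ U → expand A S ⊆ expand A U
expand-mono A S⊆U x∈ with expand-∈⁻ A x∈
... | y , y∈S , refl = expand-∈⁺ A (S⊆U y∈S)

expand-⊥ : ∀ {n} (A : Subset n) → expand A ⊥ ≡ ⊥
expand-⊥ []          = refl
expand-⊥ (true ∷ A)  = cong (false ∷_) (expand-⊥ A)
expand-⊥ (false ∷ A) = cong (false ∷_) (expand-⊥ A)

expand-⊤ : ∀ {n} (A : Subset n) → expand A ⊤ ≡ A
expand-⊤ []          = refl
expand-⊤ (true ∷ A)  = cong (true ∷_) (expand-⊤ A)
expand-⊤ (false ∷ A) = cong (false ∷_) (expand-⊤ A)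

size-expand : ∀ {n} (A : Subset n) S → size (expand A S) ≡ size S
size-expand []          []          = refl
size-expand (true ∷ A)  (true ∷ S)  = cong suc (size-expand A S)
size-expand (true ∷ A)  (false ∷ S) = size-expand A S
size-expand (false ∷ A) S           = size-expand A S

restrict-matroid : ∀ {n} (M : SetSystem n) → IsMatroid M → (A : Subset n) → IsMatroid (restrict M A)
restrict-matroid M mM A = record
  { indep-∅        = subst (T ∘ indep M) (sym (expand-⊥ A)) (indep-∅ mM)
  ; indep-⊆        = λ S U S⊆U → indep-⊆ mM (expand A S) (expand A U) (expand-mono A S⊆U)
  ; indep-exchange = exchange
  }
  where
  open IsMatroid
  exchange : ∀ S U → T (indep (restrict M A) S) → T (indep (restrict M A) U) → size S < size U →
             ∃ λ y → y ∈ U × y ∉ S × T (indep (restrict M A) (S ∪ ⁅ y ⁆))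
  exchange S U iS iU S<U
    with indep-exchange mM (expand A S) (expand A U) iS iU
           (subst₂ _<_ (sym (size-expand A S)) (sym (size-expand A U)) S<U)
  ... | x , x∈U , x∉S , iS+x with expand-∈⁻ A x∈U
  ...   | y , y∈U , refl =
    y , y∈U , x∉S ∘ expand-∈⁺ A , indep-⊆ mM _ _ expand-∪ iS+x
    where
    expand-∪ : expand A (S ∪ ⁅ y ⁆) ⊆ expand A S ∪ ⁅ emb A y ⁆
    expand-∪ x∈ with expand-∈⁻ A x∈
    ... | z , z∈ , refl with x∈p∪q⁻ S ⁅ y ⁆ z∈
    ...   | inj₁ z∈S  = x∈p∪q⁺ (inj₁ (expand-∈⁺ A z∈S))
    ...   | inj₂ z∈⁅y⁆ rewrite x∈⁅y⁆⇒x≡y y z∈⁅y⁆ = x∈p∪q⁺ (inj₂ (x∈⁅x⁆ (emb A y)))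

matroid-cong : ∀ {n} {N N' : SetSystem n} → (∀ S → indep N S ≡ indep N' S) → IsMatroid N → IsMatroid N'
matroid-cong {N = N} {N'} same mN = record
  { indep-∅        = to (IsMatroid.indep-∅ mN)
  ; indep-⊆        = λ S U S⊆U → to ∘ IsMatroid.indep-⊆ mN S U S⊆U ∘ from
  ; indep-exchange = λ S U iS iU S<U →
      let y , y∈U , y∉S , iS+y = IsMatroid.indep-exchange mN S U (from iS) (from iU) S<U
      in y , y∈U , y∉S , to iS+y
  }
  where
  to : ∀ {S} → T (indep N S) → T (indep N' S)
  to {S} = subst T (same S)
  from : ∀ {S} → T (indep N' S) → T (indep N S)
  from {S} = subst T (sym (same S))

module Contraction {n} (M : SetSystem n) (A : Subset n) where

  R : Subset n
  R = ∁ A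

  N' : SetSystem (size R)
  N' = restrict (dual M) R

  outside-basis-coindep : ∀ {B} → IsBasis M B → T (indep N' (compress R (∁ B)))
  outside-basis-coindep {B} bB = dual-indep⁺ M bB (expand-compress R (∁ B))

  contract-∅ : T (indep M ⊥) → T (indep (contract M A) ⊥)
  contract-∅ i∅ = dual-∅ N' (subst (T ∘ indep (dual M)) (sym (expand-⊥ R)) (dual-∅ M i∅))

  contract-free⁺ : T (indep M ⊥) → (∀ B → IsBasis M B → R ⊆ B) → T (indep (contract M A) ⊤)
  contract-free⁺ i∅ R⊆bases = dual-indep⁺ N' {S = ⊤} (i∅' , ∅-maximal) (λ _ → x∉p⇒x∈∁p ∉⊥)
    where
    i∅' : T (indep N' ⊥)
    i∅' = subst (T ∘ indep (dual M)) (sym (expand-⊥ R)) (dual-∅ M i∅)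
    ∅-maximal : ∀ U → T (indep N' U) → ⊥ ⊆ U → U ⊆ ⊥
    ∅-maximal U iU _ {y} y∈U with dual-indep⁻ M (expand R U) iU
    ... | B , bB , U⊆∁B = ⊥-elim (x∈∁p⇒x∉p (U⊆∁B (expand-∈⁺ R y∈U)) (R⊆bases B bB (emb-∈ R y)))

  contract-free⁻ : T (indep (contract M A) ⊤) → ∀ B → IsBasis M B → R ⊆ B
  contract-free⁻ free B bB {x} x∈R with x ∈? B
  ... | yes x∈B = x∈B
  ... | no  x∉B with dual-indep⁻ N' ⊤ free | ∈⇒emb R x∈R
  ...   | B' , (_ , B'-maximal) , ⊤⊆∁B' | y , refl =
    ⊥-elim (x∈∁p⇒x∉p (⊤⊆∁B' ∈⊤) (B'-maximal (compress R (∁ B)) (outside-basis-coindep bB)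
                                   (λ y∈B' → ⊥-elim (x∈∁p⇒x∉p (⊤⊆∁B' ∈⊤) y∈B'))
                                   (compress-∈⁺ R y (x∉p⇒x∈∁p x∉B))))

  contract⇒delete : IsMatroid M → ∀ S → T (indep (contract M A) S) → T (indep (restrict M R) S)
  contract⇒delete mM S iS with dual-indep⁻ N' S iS
  ... | B' , (iB' , B'-maximal) , S⊆∁B' with dual-indep⁻ M (expand R B') iB'
  ...   | B , bB , B'⊆∁B = IsMatroid.indep-⊆ mM (expand R S) B inside-B (proj₁ bB)
    where
    inside-B : expand R S ⊆ B
    inside-B x∈ with expand-∈⁻ R x∈
    ... | y , y∈S , refl with emb R y ∈? B
    ...   | yes x∈B = x∈B
    ...   | no  x∉B = ⊥-elim (x∈∁p⇒x∉p (S⊆∁B' y∈S)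
              (B'-maximal (compress R (∁ B)) (outside-basis-coindep bB)
                 (λ {z} z∈B' → compress-∈⁺ R z (B'⊆∁B (expand-∈⁺ R z∈B')))
                 (compress-∈⁺ R y (x∉p⇒x∈∁p x∉B))))

  -- A meets every basis of M in the same set
  MeetsBasesAlike : Set
  MeetsBasesAlike = ∀ B B₂ → IsBasis M B → IsBasis M B₂ → ∀ {x} → x ∈ A → x ∈ B₂ → x ∈ B

  -- conversely, if A meets all bases alike, M ∖ A and M / A have the same independent sets:
  -- extend S to a basis B of M; then R ∖ B is a basis of M* | R avoiding S
  delete⇒contract : MeetsBasesAlike → ∀ S → T (indep (restrict M R) S) → T (indep (contract M A) S)
  delete⇒contract alike S iS with basis-extension M (expand R S) iS
  ... | B , bB , S⊆B = dual-indep⁺ N' (outside-basis-coindep bB , B'-maximal) S⊆∁B'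
    where
    B' : Subset (size R)
    B' = compress R (∁ B)
    B'-maximal : ∀ U' → T (indep N' U') → B' ⊆ U' → U' ⊆ B'
    B'-maximal U' iU' B'⊆U' {y} y∈U' with dual-indep⁻ M (expand R U') iU'
    ... | B₂ , bB₂ , U'⊆∁B₂ =
      compress-∈⁺ R y (x∉p⇒x∈∁p (x∈∁p⇒x∉p (U'⊆∁B₂ (expand-∈⁺ R y∈U')) ∘ B⊆B₂))
      where
      B₂⊆B : B₂ ⊆ B
      B₂⊆B {x} x∈B₂ with x ∈? B | x ∈? A
      ... | yes x∈B | _       = x∈B
      ... | no  _   | yes x∈A = alike B B₂ bB bB₂ x∈A x∈B₂
      ... | no  x∉B | no  x∉A with ∈⇒emb R (x∉p⇒x∈∁p x∉A)
      ...   | z , refl = ⊥-elim (x∈∁p⇒x∉p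
                           (U'⊆∁B₂ (expand-∈⁺ R (B'⊆U' (compress-∈⁺ R z (x∉p⇒x∈∁p x∉B))))) x∈B₂)
      B⊆B₂ : B ⊆ B₂
      B⊆B₂ = proj₂ bB₂ B (proj₁ bB) B₂⊆B
    S⊆∁B' : S ⊆ ∁ B'
    S⊆∁B' {y} y∈S = x∉p⇒x∈∁p (λ y∈B' → x∈∁p⇒x∉p (compress-∈⁻ R y y∈B') (S⊆B (expand-∈⁺ R y∈S)))

T-ext : ∀ {a b} → (T a → T b) → (T b → T a) → a ≡ b
T-ext {true}  {true}  _ _ = refl
T-ext {true}  {false} f _ = ⊥-elim (f _)
T-ext {false} {true}  _ g = ⊥-elim (g _)
T-ext {false} {false} _ _ = refl

IsoInvariant : (∀ {n} → SetSystem n → Series 4) → Set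
IsoInvariant Q = ∀ {n m} (M : SetSystem n) (M' : SetSystem m) → IsMatroid M → IsMatroid M' →
                 Iso M M' → Q M ≈ Q M'

module Element {n} (M : SetSystem n) (mM : IsMatroid M) (e : Fin n) where
  open IsMatroid mM
  open Contraction M using (contract-free⁺; contract-free⁻; contract⇒delete; delete⇒contract; MeetsBasesAlike)

  -- the test used by δcoloop (M / (E ∖ e)): M / (E ∖ e) is free
  isColoopᵇ : Bool
  isColoopᵇ = indep (contract M (∁ ⁅ e ⁆)) ⊤

  -- the test used by δloop (M | {e}), up to the independence of ∅: {e} is independent
  isNonloopᵇ : Bool
  isNonloopᵇ = indep M ⁅ e ⁆

  private
    e∈∁∁⁅e⁆ : e ∈ ∁ (∁ ⁅ e ⁆)
    e∈∁∁⁅e⁆ = subst (e ∈_) (sym (∁-involutive ⁅ e ⁆)) (x∈⁅x⁆ e)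

    ∈∁∁⁅e⁆ : ∀ {x} → x ∈ ∁ (∁ ⁅ e ⁆) → x ≡ e
    ∈∁∁⁅e⁆ {x} p = x∈⁅y⁆⇒x≡y e (subst (x ∈_) (∁-involutive ⁅ e ⁆) p)

  coloop⇒ᵇ : IsColoop M e → T isColoopᵇ
  coloop⇒ᵇ coloop = contract-free⁺ (∁ ⁅ e ⁆) indep-∅ in-every-basis
    where
    in-every-basis : ∀ B → IsBasis M B → ∁ (∁ ⁅ e ⁆) ⊆ B
    in-every-basis B bB x∈ rewrite ∈∁∁⁅e⁆ x∈ = coloop B (isBasis-complete M B bB)

  ᵇ⇒coloop : T isColoopᵇ → IsColoop M e
  ᵇ⇒coloop free B tB = contract-free⁻ (∁ ⁅ e ⁆) free B (isBasis-sound M B tB) e∈∁∁⁅e⁆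

  -- some basis exists since ∅ is independent; a coloop lies in it, so is not a loop
  coloop⇒nonloop : IsColoop M e → T isNonloopᵇ
  coloop⇒nonloop coloop with basis-extension M ⊥ indep-∅
  ... | B , bB , _ = indep-⊆ ⁅ e ⁆ B ⁅e⁆⊆B (proj₁ bB)
    where
    ⁅e⁆⊆B : ⁅ e ⁆ ⊆ B
    ⁅e⁆⊆B x∈ rewrite x∈⁅y⁆⇒x≡y e x∈ = coloop B (isBasis-complete M B bB)

  loop⇒ᵇ : IsLoop M e → isNonloopᵇ ≡ false
  loop⇒ᵇ (_ , dependent) = Equivalence.to T-not-≡ dependent

  ᵇ⇒loop : isNonloopᵇ ≡ false → IsLoop M e
  ᵇ⇒loop dependent = indep-∅ , Equivalence.from T-not-≡ dependent

  -- a coloop lies in every basis, a loop in none: either way {e} meets all bases alike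
  coloop-alike : IsColoop M e → MeetsBasesAlike ⁅ e ⁆
  coloop-alike coloop B _ bB _ x∈⁅e⁆ _ rewrite x∈⁅y⁆⇒x≡y e x∈⁅e⁆ = coloop B (isBasis-complete M B bB)

  loop-alike : IsLoop M e → MeetsBasesAlike ⁅ e ⁆
  loop-alike (_ , dependent) _ B₂ _ bB₂ x∈⁅e⁆ x∈B₂ rewrite x∈⁅y⁆⇒x≡y e x∈⁅e⁆ =
    ⊥-elim (subst (T ∘ not) (Equivalence.to T-≡ (indep-⊆ ⁅ e ⁆ B₂ ⁅e⁆⊆B₂ (proj₁ bB₂))) dependent)
    where
    ⁅e⁆⊆B₂ : ⁅ e ⁆ ⊆ B₂
    ⁅e⁆⊆B₂ y∈ rewrite x∈⁅y⁆⇒x≡y e y∈ = x∈B₂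

  -- then M / e and M ∖ e coincide, so an isomorphism-invariant Q agrees on them
  Q-contract≈delete : ∀ (Q : ∀ {n} → SetSystem n → Series 4) → IsoInvariant Q →
                      MeetsBasesAlike ⁅ e ⁆ → Q (contract₁ M e) ≈ Q (delete₁ M e)
  Q-contract≈delete Q invariant alike =
    invariant (contract₁ M e) (delete₁ M e) (matroid-cong (sym ∘ same) matroid∖e) matroid∖e
      record { bij = ⤖-id _ ; preserves = λ S → trans (cong (indep (contract₁ M e)) (tabulate∘lookup S)) (same S) }
    where
    same : ∀ S → indep (contract₁ M e) S ≡ indep (delete₁ M e) S
    same S = T-ext (contract⇒delete ⁅ e ⁆ mM S) (delete⇒contract ⁅ e ⁆ alike S)
    matroid∖e : IsMatroid (delete₁ M e)
    matroid∖e = restrict-matroid M mM (∁ ⁅ e ⁆)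

ColoopRule LoopRule GenericRule : (∀ {n} → SetSystem n → Series 4) → Set
ColoopRule Q = ∀ {n} (M : SetSystem n) (e : Fin n) → IsMatroid M → IsColoop M e →
               Q M ≈ x₄ *ₚ Q (delete₁ M e)
LoopRule Q = ∀ {n} (M : SetSystem n) (e : Fin n) → IsMatroid M → IsLoop M e →
             Q M ≈ y₄ *ₚ Q (contract₁ M e)
GenericRule Q = ∀ {n} (M : SetSystem n) (e : Fin n) → IsMatroid M → ¬ IsLoop M e → ¬ IsColoop M e →
                Q M ≈ a₄ *ₚ Q (delete₁ M e) +ₚ b₄ *ₚ Q (contract₁ M e)

ix iy ia ib : Fin 4
ix = Fin.zero
iy = Fin.suc Fin.zero
ia = Fin.suc (Fin.suc Fin.zero)
ib = Fin.suc (Fin.suc (Fin.suc Fin.zero))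

-- The contribution of one element e to the right-hand side of the theorem,
-- given whether e is a coloop / a nonloop and the polynomials D = Q(M ∖ e),
-- C = Q(M / e):  x[col]D + y[loop]C + b([nonloop]C − [col]D) − a([loop]C − [noncol]D).
contribution : Bool → Bool → Series 4 → Series 4 → Vec ℕ 4 → ℚ
contribution col nonloop D C m =
    (when col (timesVar ix D m) ℚ.+ when (not nonloop) (timesVar iy C m))
  ℚ.+ (when nonloop (timesVar ib C m) ℚ.- when col (timesVar ib D m))
  ℚ.- (when (not nonloop) (timesVar ia C m) ℚ.- when (not col) (timesVar ia D m))

module Recurrence (Q : ∀ {n} → SetSystem n → Series 4) (invariant : IsoInvariant Q)
                  (coloopRule : ColoopRule Q) (loopRule : LoopRule Q) (genericRule : GenericRule Q)
                  {n} (M : SetSystem n) (mM : IsMatroid M) (e : Fin n) where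
  open Element M mM e
  open ≡-Reasoning

  D C : Series 4
  D = Q (delete₁ M e)
  C = Q (contract₁ M e)

  -- a coloop contributes x·D + b·(C − D) = x·D, as C = D
  coloop-contribution : IsColoop M e → ∀ m → contribution true true D C m ≡ Q M m
  coloop-contribution coloop m = begin
      ((X ℚ.+ 0ℚ) ℚ.+ (timesVar ib C m ℚ.- timesVar ib D m)) ℚ.- (0ℚ ℚ.- 0ℚ)
    ≡⟨ cong (λ t → ((X ℚ.+ 0ℚ) ℚ.+ (t ℚ.- timesVar ib D m)) ℚ.- (0ℚ ℚ.- 0ℚ))
            (timesVar-cong ib (Q-contract≈delete Q invariant (coloop-alike coloop)) m) ⟩
      ((X ℚ.+ 0ℚ) ℚ.+ (timesVar ib D m ℚ.- timesVar ib D m)) ℚ.- (0ℚ ℚ.- 0ℚ)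
    ≡⟨ solve 2 (λ x b → ((x :+ con 0ℚ) :+ (b :- b)) :- (con 0ℚ :- con 0ℚ) := x) refl X (timesVar ib D m) ⟩
      X
    ≡⟨ sym (trans (coloopRule M e mM coloop m) (var-*ₚ ix D m)) ⟩
      Q M m
    ∎
    where X = timesVar ix D m

  -- a loop contributes y·C − a·(C − D) = y·C, as C = D
  loop-contribution : IsLoop M e → ∀ m → contribution false false D C m ≡ Q M m
  loop-contribution loop m = begin
      ((0ℚ ℚ.+ Y) ℚ.+ (0ℚ ℚ.- 0ℚ)) ℚ.- (timesVar ia C m ℚ.- timesVar ia D m)
    ≡⟨ cong (λ t → ((0ℚ ℚ.+ Y) ℚ.+ (0ℚ ℚ.- 0ℚ)) ℚ.- (t ℚ.- timesVar ia D m))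
            (timesVar-cong ia (Q-contract≈delete Q invariant (loop-alike loop)) m) ⟩
      ((0ℚ ℚ.+ Y) ℚ.+ (0ℚ ℚ.- 0ℚ)) ℚ.- (timesVar ia D m ℚ.- timesVar ia D m)
    ≡⟨ solve 2 (λ y a → ((con 0ℚ :+ y) :+ (con 0ℚ :- con 0ℚ)) :- (a :- a) := y) refl Y (timesVar ia D m) ⟩
      Y
    ≡⟨ sym (trans (loopRule M e mM loop m) (var-*ₚ iy C m)) ⟩
      Q M m
    ∎
    where Y = timesVar iy C m

  generic-contribution : ¬ IsLoop M e → ¬ IsColoop M e → ∀ m → contribution false true D C m ≡ Q M m
  generic-contribution not-loop not-coloop m = begin
      ((0ℚ ℚ.+ 0ℚ) ℚ.+ (B ℚ.- 0ℚ)) ℚ.- (0ℚ ℚ.- A)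
    ≡⟨ solve 2 (λ b a → ((con 0ℚ :+ con 0ℚ) :+ (b :- con 0ℚ)) :- (con 0ℚ :- a) := a :+ b) refl B A ⟩
      A ℚ.+ B
    ≡⟨ sym (trans (genericRule M e mM not-loop not-coloop m) (cong₂ ℚ._+_ (var-*ₚ ia D m) (var-*ₚ ib C m))) ⟩
      Q M m
    ∎
    where
    A = timesVar ia D m
    B = timesVar ib C m

  -- each element contributes exactly Q_M; a coloop is never a loop
  contribution≡Q : ∀ m → contribution isColoopᵇ isNonloopᵇ D C m ≡ Q M m
  contribution≡Q m with isColoopᵇ in col | isNonloopᵇ in nonloop
  ... | true  | true  = coloop-contribution (ᵇ⇒coloop (Equivalence.from T-≡ col)) m
  ... | true  | false = ⊥-elim (subst T nonloop (coloop⇒nonloop (ᵇ⇒coloop (Equivalence.from T-≡ col))))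
  ... | false | false = loop-contribution (ᵇ⇒loop nonloop) m
  ... | false | true  = generic-contribution
      (λ loop → subst T (loop⇒ᵇ loop) (Equivalence.from T-≡ nonloop))
      (λ coloop → subst T col (coloop⇒ᵇ coloop)) m

-- E ∖ e has one element less than E, so row j of β(M ∖ e) is row j + 1 of β(M)
row-guard : ∀ {n} (e : Fin n) j → (j ≡ᵇ size (∁ ⁅ e ⁆)) ≡ (suc j ≡ᵇ n)
row-guard {suc k} e j = cong (j ≡ᵇ_) (size-∁⁅⁆ e)
  where
  size-∁⊥ : ∀ {n} → size (∁ (⊥ {n})) ≡ n
  size-∁⊥ {zero}  = refl
  size-∁⊥ {suc n} = cong suc (size-∁⊥ {n})
  size-∁⁅⁆ : ∀ {k} (e : Fin (suc k)) → size (∁ ⁅ e ⁆) ≡ k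
  size-∁⁅⁆ {k}     Fin.zero    = size-∁⊥ {k}
  size-∁⁅⁆ {suc k} (Fin.suc e) = cong suc (size-∁⁅⁆ e)

β-rows : ∀ (Q : ∀ {n} → SetSystem n → Series 4) n (N : (e : Fin n) → SetSystem (size (∁ ⁅ e ⁆)))
           (test test' : Fin n → Bool) → (∀ e → test' e ≡ test e) → ∀ j v →
         sumFin n (λ e → when (test' e) (β Q (N e) (j ∷ v)))
           ≡ when (suc j ≡ᵇ n) (sumFin n (λ e → when (test e) (Q (N e) v)))
β-rows Q n N test test' same j v =
  trans (sumFin-cong n row) (sumFin-when n (suc j ≡ᵇ n) (λ e → when (test e) (Q (N e) v)))
  where
  swap : ∀ b g q → when b (when g q) ≡ when g (when b q)
  swap true  g     q = refl
  swap false true  q = refl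
  swap false false q = refl
  row : ∀ e → when (test' e) (β Q (N e) (j ∷ v)) ≡ when (suc j ≡ᵇ n) (when (test e) (Q (N e) v))
  row e rewrite same e | β-row Q (N e) j v | row-guard e j = swap (test e) (suc j ≡ᵇ n) (Q (N e) v)

timesVar-rows : ∀ (i : Fin 4) g n (test : Fin n → Bool) (G : Fin n → Series 4) (F : Series 4) →
  (∀ v → F v ≡ when g (sumFin n (λ e → when (test e) (G e v)))) →
  ∀ m → timesVar i F m ≡ when g (sumFin n (λ e → when (test e) (timesVar i (G e) m)))
timesVar-rows i g n test G F F≈ m = begin
    timesVar i F m
  ≡⟨ timesVar-cong i F≈ m ⟩
    timesVar i (λ v → when g (sumFin n (λ e → when (test e) (G e v)))) m
  ≡⟨ timesVar-when i g _ m ⟩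
    when g (timesVar i (λ v → sumFin n (λ e → when (test e) (G e v))) m)
  ≡⟨ cong (when g) (timesVar-sumFin i n (λ e v → when (test e) (G e v)) m) ⟩
    when g (sumFin n (λ e → timesVar i (λ v → when (test e) (G e v)) m))
  ≡⟨ cong (when g) (sumFin-cong n (λ e → timesVar-when i (test e) (G e) m)) ⟩
    when g (sumFin n (λ e → when (test e) (timesVar i (G e) m)))
  ∎
  where open ≡-Reasoning

when-combine : ∀ g a b c d e f →
  ((when g a ℚ.+ when g b) ℚ.+ (when g c ℚ.- when g d)) ℚ.- (when g e ℚ.- when g f)
    ≡ when g (((a ℚ.+ b) ℚ.+ (c ℚ.- d)) ℚ.- (e ℚ.- f))
when-combine true  a b c d e f = refl
when-combine false a b c d e f = refl

sumFin-combine : ∀ n (a b c d e f : Fin n → ℚ) →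
  ((sumFin n a ℚ.+ sumFin n b) ℚ.+ (sumFin n c ℚ.- sumFin n d)) ℚ.- (sumFin n e ℚ.- sumFin n f)
    ≡ sumFin n (λ i → ((a i ℚ.+ b i) ℚ.+ (c i ℚ.- d i)) ℚ.- (e i ℚ.- f i))
sumFin-combine n a b c d e f = sym (begin
    sumFin n (λ i → ((a i ℚ.+ b i) ℚ.+ (c i ℚ.- d i)) ℚ.- (e i ℚ.- f i))
  ≡⟨ sumFin-- n _ _ ⟩
    sumFin n (λ i → (a i ℚ.+ b i) ℚ.+ (c i ℚ.- d i)) ℚ.- sumFin n (λ i → e i ℚ.- f i)
  ≡⟨ cong₂ ℚ._-_ (sumFin-+ n _ _) (sumFin-- n e f) ⟩
    (sumFin n (λ i → a i ℚ.+ b i) ℚ.+ sumFin n (λ i → c i ℚ.- d i)) ℚ.- (sumFin n e ℚ.- sumFin n f)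
  ≡⟨ cong (ℚ._- (sumFin n e ℚ.- sumFin n f)) (cong₂ ℚ._+_ (sumFin-+ n a b) (sumFin-- n c d)) ⟩
    ((sumFin n a ℚ.+ sumFin n b) ℚ.+ (sumFin n c ℚ.- sumFin n d)) ℚ.- (sumFin n e ℚ.- sumFin n f)
  ∎)
  where open ≡-Reasoning

module RightHandSide (Q : ∀ {n} → SetSystem n → Series 4) {n} (M : SetSystem n) (mM : IsMatroid M) (j : ℕ) where

  col nonloop : Fin n → Bool
  col     = Element.isColoopᵇ M mM
  nonloop = Element.isNonloopᵇ M mM

  D C : Fin n → Series 4
  D e = Q (delete₁ M e)
  C e = Q (contract₁ M e)

  -- the row j of β(M) has index j + 1 for the one-element minors
  g : Bool
  g = suc j ≡ᵇ n

  Row : Series 5 → (Fin n → Bool) → (Fin n → Series 4) → Set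
  Row F test G = ∀ v → F (j ∷ v) ≡ when g (sumFin n (λ e → when (test e) (G e v)))

  i∅ : indep M ⊥ ≡ true
  i∅ = Equivalence.to T-≡ (IsMatroid.indep-∅ mM)

  -- β ⋆ δcoloop sees the coloops e, through M ∖ e
  coloop-row : Row ((β Q ⋆ δcoloop) M) col D
  coloop-row v = trans (⋆δ-apply (β Q) isColoopMatroid M (j ∷ v))
                       (β-rows Q n (delete₁ M) col col (λ _ → refl) j v)

  -- β ⋆ δloop sees the non-coloops e, through M ∖ e
  noncoloop-row : Row ((β Q ⋆ δloop) M) (not ∘ col) D
  noncoloop-row v = trans (⋆δ-apply (β Q) isLoopMatroid M (j ∷ v))
                          (β-rows Q n (delete₁ M) (not ∘ col) _ same j v)
    where
    same : ∀ e → isLoopMatroid (contract M (∁ ⁅ e ⁆)) ≡ not (col e)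
    same e = cong (_∧ not (col e)) (Equivalence.to T-≡ (Contraction.contract-∅ M (∁ ⁅ e ⁆) (IsMatroid.indep-∅ mM)))

  -- δcoloop ⋆ β sees the nonloops e, through M / e
  nonloop-row : Row ((δcoloop ⋆ β Q) M) nonloop C
  nonloop-row v = trans (δ⋆-apply isColoopMatroid (β Q) M (j ∷ v))
                        (β-rows Q n (contract₁ M) nonloop _ (λ e → cong (indep M) (expand-⊤ ⁅ e ⁆)) j v)

  -- δloop ⋆ β sees the loops e, through M / e
  loop-row : Row ((δloop ⋆ β Q) M) (not ∘ nonloop) C
  loop-row v = trans (δ⋆-apply isLoopMatroid (β Q) M (j ∷ v))
                     (β-rows Q n (contract₁ M) (not ∘ nonloop) _ same j v)
    where
    same : ∀ e → isLoopMatroid (restrict M ⁅ e ⁆) ≡ not (nonloop e)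
    same e rewrite expand-⊥ ⁅ e ⁆ | expand-⊤ ⁅ e ⁆ | i∅ = refl

  RHS : Series 5
  RHS = xv *ₚ (β Q ⋆ δcoloop) M +ₚ yv *ₚ (δloop ⋆ β Q) M
        +ₚ bv *ₚ [ δcoloop , β Q ]⋆ M -ₚ av *ₚ [ δloop , β Q ]⋆ M

  rhs-row : ∀ m → RHS (j ∷ m) ≡ when g (sumFin n (λ e → contribution (col e) (nonloop e) (D e) (C e) m))
  rhs-row m = begin
      RHS (j ∷ m)
    ≡⟨ cong₂ ℚ._-_ (cong₂ ℚ._+_ (cong₂ ℚ._+_ (var-*ₚ (Fin.suc ix) C₁ (j ∷ m)) (var-*ₚ (Fin.suc iy) L₁ (j ∷ m)))
                                (var-*ₚ (Fin.suc ib) (C₂ -ₚ C₁) (j ∷ m)))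
                   (var-*ₚ (Fin.suc ia) (L₁ -ₚ L₂) (j ∷ m)) ⟩
      ((timesVar ix (slice C₁ j) m ℚ.+ timesVar iy (slice L₁ j) m)
        ℚ.+ timesVar ib (slice C₂ j -ₚ slice C₁ j) m) ℚ.- timesVar ia (slice L₁ j -ₚ slice L₂ j) m
    ≡⟨ cong₂ (λ s t → ((timesVar ix (slice C₁ j) m ℚ.+ timesVar iy (slice L₁ j) m) ℚ.+ s) ℚ.- t)
             (timesVar-- ib (slice C₂ j) (slice C₁ j) m) (timesVar-- ia (slice L₁ j) (slice L₂ j) m) ⟩
      ((timesVar ix (slice C₁ j) m ℚ.+ timesVar iy (slice L₁ j) m)
        ℚ.+ (timesVar ib (slice C₂ j) m ℚ.- timesVar ib (slice C₁ j) m))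
        ℚ.- (timesVar ia (slice L₁ j) m ℚ.- timesVar ia (slice L₂ j) m)
    ≡⟨ cong₂ ℚ._-_
         (cong₂ ℚ._+_ (cong₂ ℚ._+_ (rows ix C₁ col D coloop-row) (rows iy L₁ (not ∘ nonloop) C loop-row))
                      (cong₂ ℚ._-_ (rows ib C₂ nonloop C nonloop-row) (rows ib C₁ col D coloop-row)))
         (cong₂ ℚ._-_ (rows ia L₁ (not ∘ nonloop) C loop-row) (rows ia L₂ (not ∘ col) D noncoloop-row)) ⟩
      _
    ≡⟨ when-combine g _ _ _ _ _ _ ⟩
      _
    ≡⟨ cong (when g) (sumFin-combine n _ _ _ _ _ _) ⟩
      when g (sumFin n (λ e → contribution (col e) (nonloop e) (D e) (C e) m))
    ∎
    where
    open ≡-Reasoning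
    C₁ = (β Q ⋆ δcoloop) M
    C₂ = (δcoloop ⋆ β Q) M
    L₁ = (δloop ⋆ β Q) M
    L₂ = (β Q ⋆ δloop) M
    rows : ∀ i F test G → Row F test G →
           timesVar i (slice F j) m ≡ when g (sumFin n (λ e → when (test e) (timesVar i (G e) m)))
    rows i F test G row = timesVar-rows i g n test G (slice F j) row m

-- d/ds β(M) in row j: the factor j + 1 is |E| whenever row j + 1 of β(M) is nonzero
scale-row : ∀ k n q → fromℕℚ k ℚ.* when (k ≡ᵇ n) q ≡ when (k ≡ᵇ n) (fromℕℚ n ℚ.* q)
scale-row k n q with k ≡ᵇ n in k≡n
... | true  rewrite ℕP.≡ᵇ⇒≡ k n (Equivalence.from T-≡ k≡n) = refl
... | false = ℚP.*-zeroʳ (fromℕℚ k)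

mainTheorem6 :
    (Q : ∀ {n} → SetSystem n → Series 4) →
    (∀ {n m} (M : SetSystem n) (M' : SetSystem m) → IsMatroid M → IsMatroid M' →
      Iso M M' → Q M ≈ Q M') →
    (∀ {n} (M : SetSystem n) → IsMatroid M → IsPoly (Q M)) →
    (∀ {n₁ n₂} (M₁ : SetSystem n₁) (M₂ : SetSystem n₂) → IsMatroid M₁ → IsMatroid M₂ →
      Q (M₁ ⊕ M₂) ≈ Q M₁ *ₚ Q M₂) →
    Q emptyMatroid ≈ 1ₚ →
    (∀ {n} (M : SetSystem n) (e : Fin n) → IsMatroid M → IsColoop M e →
      Q M ≈ x₄ *ₚ Q (delete₁ M e)) →
    (∀ {n} (M : SetSystem n) (e : Fin n) → IsMatroid M → IsLoop M e →
      Q M ≈ y₄ *ₚ Q (contract₁ M e)) →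
    (∀ {n} (M : SetSystem n) (e : Fin n) → IsMatroid M → ¬ IsLoop M e → ¬ IsColoop M e →
      Q M ≈ a₄ *ₚ Q (delete₁ M e) +ₚ b₄ *ₚ Q (contract₁ M e)) →
    ∀ {n} (M : SetSystem n) → IsMatroid M →
      d/ds (β Q M) ≈
        xv *ₚ (β Q ⋆ δcoloop) M +ₚ yv *ₚ (δloop ⋆ β Q) M
        +ₚ bv *ₚ [ δcoloop , β Q ]⋆ M -ₚ av *ₚ [ δloop , β Q ]⋆ M
mainTheorem6 Q invariant _ _ _ coloopRule loopRule genericRule {n} M mM (j ∷ m) = begin
    fromℕℚ (suc j) ℚ.* β Q M (suc j ∷ m)
  ≡⟨ cong (fromℕℚ (suc j) ℚ.*_) (β-row Q M (suc j) m) ⟩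
    fromℕℚ (suc j) ℚ.* when g (Q M m)
  ≡⟨ scale-row (suc j) n (Q M m) ⟩
    when g (fromℕℚ n ℚ.* Q M m)
  ≡⟨ cong (when g) (sym (sumFin-const n (Q M m))) ⟩
    when g (sumFin n (λ _ → Q M m))
  ≡⟨ cong (when g) (sumFin-cong n (λ e → sym (Recurrence.contribution≡Q
                                                Q invariant coloopRule loopRule genericRule M mM e m))) ⟩
    when g (sumFin n (λ e → contribution (col e) (nonloop e) (D e) (C e) m))
  ≡⟨ sym (rhs-row m) ⟩
    RHS (j ∷ m)
  ∎
  where
  open ≡-Reasoning
  open RightHandSide Q M mM j
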